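{- Let $n\ge 1$ and let $V$ be a matching in $Q_n$ (a set of pairwise vertex-disjoint edges of $Q_n$). Let $E_n\subseteq\{0,1\}^n$ be the set of vectors of even parity (even number of $1$'s) and $O_n\subseteq\{0,1\}^n$ the set of vectors of odd parity. For $X_1,X_2,X_3,X_4$, each equal to one of $E_n,O_n,V$ with exactly one of them equal to $V$, let $(X_1,X_2,X_3,X_4)$ denote the set of edges of $Q_{4n}$ obtained by concatenating $x_1,x_2,x_3,x_4$ (in this order, $x_i$ occupying coordinates $(i-1)n+1,\dots,in$), where $x_i\in X_i$; here the entry from $V$ is an edge $\{a,b\}$ of $Q_n$, and the concatenation means the edge of $Q_{4n}$ whose two endpoints are obtained by concatenating the three fixed vertices with $a$ and with $b$ respectively. Define \[ \mathrm{BinPS}(4,2)=(V,E_n,E_n,E_n)\cup(E_n,V,O_n,E_n)\cup(E_n,E_n,V,O_n)\cup(E_n,O_n,E_n,V)\] \[\cup(V,O_n,O_n,O_n)\cup(O_n,V,E_n,O_n)\cup(O_n,O_n,V,E_n)\cup(O_n,E_n,O_n,V). \] Then $\mathrm{BinPS}(4,2)$ is a matching in $Q_{4n}$ (hence can be used as a pairing strategy for a game played on the vertices of $Q_{4n}$).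
   Context: $Q_n$ is the $n$-dimensional hypercube graph: vertex set $\{0,1\}^n$, with two vertices adjacent iff they differ in exactly one coordinate. A matching is a set of pairwise disjoint edges. -}

module Defs where

open import Data.Bool using (Bool; true; false)
open import Data.Nat using (ℕ; zero; suc; _+_; _*_; _%_)
open import Data.Vec using (Vec; []; _∷_; _++_)
open import Data.Product using (_×_)
open import Data.Sum using (_⊎_)
open import Relation.Binary.PropositionalEquality using (_≡_)

Vertex : ℕ → Set
Vertex n = Vec Bool n

hamming : ∀ {n} → Vertex n → Vertex n → ℕ
hamming []       []       = 0
hamming (true  ∷ x) (true  ∷ y) = hamming x y
hamming (false ∷ x) (false ∷ y) = hamming x y
hamming (true  ∷ x) (false ∷ y) = suc (hamming x y)
hamming (false ∷ x) (true  ∷ y) = suc (hamming x y)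

Adjacent : ∀ {n} → Vertex n → Vertex n → Set
Adjacent x y = hamming x y ≡ 1

-- a set of (unordered) edges of Q_n, given as a relation:
-- R a b means that {a,b} belongs to the set (in either orientation)
EdgeRel : ℕ → Set₁
EdgeRel n = Vertex n → Vertex n → Set

Has : ∀ {n} → EdgeRel n → Vertex n → Vertex n → Set
Has R a b = R a b ⊎ R b a

IsMatching : ∀ {n} → EdgeRel n → Set
IsMatching {n} R =
  (∀ (a b : Vertex n) → R a b → Adjacent a b) ×
  (∀ (a b c : Vertex n) → Has R a b → Has R a c → b ≡ c)

ones : ∀ {n} → Vertex n → ℕ
ones []          = 0
ones (true  ∷ x) = suc (ones x)
ones (false ∷ x) = ones x

Even : ∀ {n} → Vertex n → Set
Even x = ones x % 2 ≡ 0

Odd : ∀ {n} → Vertex n → Set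
Odd x = ones x % 2 ≡ 1

cat4 : ∀ {n} → Vertex n → Vertex n → Vertex n → Vertex n → Vertex (4 * n)
cat4 x1 x2 x3 x4 = x1 ++ (x2 ++ (x3 ++ (x4 ++ [])))

data BinPS {n : ℕ} (V : EdgeRel n) : EdgeRel (4 * n) where
  p1 : ∀ {a b x2 x3 x4} → V a b → Even x2 → Even x3 → Even x4 →
       BinPS V (cat4 a x2 x3 x4) (cat4 b x2 x3 x4)
  p2 : ∀ {x1 a b x3 x4} → Even x1 → V a b → Odd x3 → Even x4 →
       BinPS V (cat4 x1 a x3 x4) (cat4 x1 b x3 x4)
  p3 : ∀ {x1 x2 a b x4} → Even x1 → Even x2 → V a b → Odd x4 →
       BinPS V (cat4 x1 x2 a x4) (cat4 x1 x2 b x4)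
  p4 : ∀ {x1 x2 x3 a b} → Even x1 → Odd x2 → Even x3 → V a b →
       BinPS V (cat4 x1 x2 x3 a) (cat4 x1 x2 x3 b)
  p5 : ∀ {a b x2 x3 x4} → V a b → Odd x2 → Odd x3 → Odd x4 →
       BinPS V (cat4 a x2 x3 x4) (cat4 b x2 x3 x4)
  p6 : ∀ {x1 a b x3 x4} → Odd x1 → V a b → Even x3 → Odd x4 →
       BinPS V (cat4 x1 a x3 x4) (cat4 x1 b x3 x4)
  p7 : ∀ {x1 x2 a b x4} → Odd x1 → Odd x2 → V a b → Even x4 →
       BinPS V (cat4 x1 x2 a x4) (cat4 x1 x2 b x4)
  p8 : ∀ {x1 x2 x3 a b} → Odd x1 → Even x2 → Odd x3 → V a b →
       BinPS V (cat4 x1 x2 x3 a) (cat4 x1 x2 x3 b)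

-- The eight
-- parity patterns of BinPS(4,2), each leaving its V-block free, partition {E,O}⁴:
-- the parities of the four blocks of a vertex therefore determine the one block in
-- which an edge of BinPS(4,2) at that vertex can move, and the edge is then the
-- V-edge at that block, which is unique because V is a matching.
module Submission where

open import Data.Bool using (Bool; true; false)
open import Data.Fin using (Fin; #_)
open import Data.Nat using (ℕ; _≤_; _*_; _+_; _≡ᵇ_; _%_)
open import Data.Nat.Properties using (+-identityʳ)
open import Data.Product using (_×_; _,_; ∃₂)
open import Data.Sum using (inj₁; inj₂)
open import Data.Vec using (Vec; []; _∷_; _++_; concat; lookup; _[_]≔_)
open import Data.Vec.Properties using (++-injectiveˡ; ++-injectiveʳ)
open import Relation.Binary.PropositionalEquality
  using (_≡_; refl; trans; cong; cong₂; module ≡-Reasoning)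
open import Defs

concat-injective : ∀ {A : Set} {m n} (xss yss : Vec (Vec A m) n) →
                   concat xss ≡ concat yss → xss ≡ yss
concat-injective []         []         _  = refl
concat-injective (xs ∷ xss) (ys ∷ yss) eq =
  cong₂ _∷_ (++-injectiveˡ xs ys eq) (concat-injective xss yss (++-injectiveʳ xs ys eq))

hamming-self : ∀ {n} (x : Vertex n) → hamming x x ≡ 0
hamming-self []          = refl
hamming-self (true  ∷ x) = hamming-self x
hamming-self (false ∷ x) = hamming-self x

hamming-sym : ∀ {n} (x y : Vertex n) → hamming x y ≡ hamming y x
hamming-sym []          []          = refl
hamming-sym (true  ∷ x) (true  ∷ y) = hamming-sym x y
hamming-sym (false ∷ x) (false ∷ y) = hamming-sym x y
hamming-sym (true  ∷ x) (false ∷ y) = cong ℕ.suc (hamming-sym x y)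
hamming-sym (false ∷ x) (true  ∷ y) = cong ℕ.suc (hamming-sym x y)

hamming-++ : ∀ {m k} (x x′ : Vertex m) (y y′ : Vertex k) →
             hamming (x ++ y) (x′ ++ y′) ≡ hamming x x′ + hamming y y′
hamming-++ []          []           y y′ = refl
hamming-++ (true  ∷ x) (true  ∷ x′) y y′ = hamming-++ x x′ y y′
hamming-++ (false ∷ x) (false ∷ x′) y y′ = hamming-++ x x′ y y′
hamming-++ (true  ∷ x) (false ∷ x′) y y′ = cong ℕ.suc (hamming-++ x x′ y y′)
hamming-++ (false ∷ x) (true  ∷ x′) y y′ = cong ℕ.suc (hamming-++ x x′ y y′)

hamming-concat-[]≔ : ∀ {m k} (xss : Vec (Vertex m) k) i b →
                     hamming (concat xss) (concat (xss [ i ]≔ b)) ≡ hamming (lookup xss i) b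
hamming-concat-[]≔ (x ∷ xss) Fin.zero b = begin
  hamming (x ++ concat xss) (b ++ concat xss)       ≡⟨ hamming-++ x b _ _ ⟩
  hamming x b + hamming (concat xss) (concat xss)   ≡⟨ cong (hamming x b +_) (hamming-self (concat xss)) ⟩
  hamming x b + 0                                   ≡⟨ +-identityʳ _ ⟩
  hamming x b                                       ∎
  where open ≡-Reasoning
hamming-concat-[]≔ (x ∷ xss) (Fin.suc i) b = begin
  hamming (x ++ concat xss) (x ++ concat (xss [ i ]≔ b))       ≡⟨ hamming-++ x x _ _ ⟩
  hamming x x + hamming (concat xss) (concat (xss [ i ]≔ b))   ≡⟨ cong₂ _+_ (hamming-self x) (hamming-concat-[]≔ xss i b) ⟩
  hamming (lookup xss i) b                                     ∎
  where open ≡-Reasoning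

Has-adjacent : ∀ {n} {R : EdgeRel n} → (∀ a b → R a b → Adjacent a b) →
               ∀ {a b} → Has R a b → Adjacent a b
Has-adjacent adjacent {a} {b} (inj₁ r) = adjacent a b r
Has-adjacent adjacent {a} {b} (inj₂ r) = trans (hamming-sym a b) (adjacent b a r)

parity : ∀ {n} → Vertex n → Bool
parity x = ones x % 2 ≡ᵇ 1

even⇒parity≡false : ∀ {n} (x : Vertex n) → Even x → parity x ≡ false
even⇒parity≡false _ e = cong (_≡ᵇ 1) e

odd⇒parity≡true : ∀ {n} (x : Vertex n) → Odd x → parity x ≡ true
odd⇒parity≡true _ o = cong (_≡ᵇ 1) o

-- With false for E and true for O, each pattern of BinPS(4,2) accounts for two rows,
-- one for each parity of its V-block.
patternBlock : Bool → Bool → Bool → Bool → Fin 4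
patternBlock false false false false = # 0
patternBlock true  false false false = # 0
patternBlock false true  true  true  = # 0
patternBlock true  true  true  true  = # 0
patternBlock false false true  false = # 1
patternBlock false true  true  false = # 1
patternBlock true  false false true  = # 1
patternBlock true  true  false true  = # 1
patternBlock false false false true  = # 2
patternBlock false false true  true  = # 2
patternBlock true  true  false false = # 2
patternBlock true  true  true  false = # 2
patternBlock false true  false false = # 3
patternBlock false true  false true  = # 3
patternBlock true  false true  false = # 3
patternBlock true  false true  true  = # 3

patternBlock-VEEE : ∀ p {q r s} → q ≡ false → r ≡ false → s ≡ false → patternBlock p q r s ≡ # 0
patternBlock-VEEE false refl refl refl = refl
patternBlock-VEEE true  refl refl refl = refl

patternBlock-EVOE : ∀ p {q r s} → q ≡ false → r ≡ true → s ≡ false → patternBlock q p r s ≡ # 1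
patternBlock-EVOE false refl refl refl = refl
patternBlock-EVOE true  refl refl refl = refl

patternBlock-EEVO : ∀ p {q r s} → q ≡ false → r ≡ false → s ≡ true → patternBlock q r p s ≡ # 2
patternBlock-EEVO false refl refl refl = refl
patternBlock-EEVO true  refl refl refl = refl

patternBlock-EOEV : ∀ p {q r s} → q ≡ false → r ≡ true → s ≡ false → patternBlock q r s p ≡ # 3
patternBlock-EOEV false refl refl refl = refl
patternBlock-EOEV true  refl refl refl = refl

patternBlock-VOOO : ∀ p {q r s} → q ≡ true → r ≡ true → s ≡ true → patternBlock p q r s ≡ # 0
patternBlock-VOOO false refl refl refl = refl
patternBlock-VOOO true  refl refl refl = refl

patternBlock-OVEO : ∀ p {q r s} → q ≡ true → r ≡ false → s ≡ true → patternBlock q p r s ≡ # 1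
patternBlock-OVEO false refl refl refl = refl
patternBlock-OVEO true  refl refl refl = refl

patternBlock-OOVE : ∀ p {q r s} → q ≡ true → r ≡ true → s ≡ false → patternBlock q r p s ≡ # 2
patternBlock-OOVE false refl refl refl = refl
patternBlock-OOVE true  refl refl refl = refl

patternBlock-OEOV : ∀ p {q r s} → q ≡ true → r ≡ false → s ≡ true → patternBlock q r s p ≡ # 3
patternBlock-OEOV false refl refl refl = refl
patternBlock-OEOV true  refl refl refl = refl

Blocks : ℕ → Set
Blocks n = Vec (Vertex n) 4

activeBlock : ∀ {n} → Blocks n → Fin 4
activeBlock (x₁ ∷ x₂ ∷ x₃ ∷ x₄ ∷ []) = patternBlock (parity x₁) (parity x₂) (parity x₃) (parity x₄)

data ActiveMove {n} (R : EdgeRel n) (xs : Blocks n) : Blocks n → Set where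
  activeMove : ∀ {b} → R (lookup xs (activeBlock xs)) b → ActiveMove R xs (xs [ activeBlock xs ]≔ b)

ActiveEdge : ∀ {n} → EdgeRel n → EdgeRel (4 * n)
ActiveEdge R u w = ∃₂ λ xs ys → u ≡ concat xs × w ≡ concat ys × ActiveMove R xs ys

activeEdge : ∀ {n} {R : EdgeRel n} xs {i b} → activeBlock xs ≡ i → R (lookup xs i) b →
             ActiveEdge R (concat xs) (concat (xs [ i ]≔ b))
activeEdge xs refl r = xs , _ , refl , refl , activeMove r

activeMove-functional : ∀ {n} {R : EdgeRel n} → (∀ {a b c} → R a b → R a c → b ≡ c) →
                        ∀ {xs ys zs} → ActiveMove R xs ys → ActiveMove R xs zs → ys ≡ zs
activeMove-functional functional {xs} (activeMove r) (activeMove r′) =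
  cong (xs [ activeBlock xs ]≔_) (functional r r′)

activeEdge-functional : ∀ {n} {R : EdgeRel n} → (∀ {a b c} → R a b → R a c → b ≡ c) →
                        ∀ {u w w′} → ActiveEdge R u w → ActiveEdge R u w′ → w ≡ w′
activeEdge-functional functional (xs , _ , refl , refl , m) (xs′ , _ , u≡ , refl , m′)
  with refl ← concat-injective xs xs′ u≡ = cong concat (activeMove-functional functional m m′)

activeEdge-adjacent : ∀ {n} {R : EdgeRel n} → (∀ {a b} → R a b → Adjacent a b) →
                      ∀ {u w} → ActiveEdge R u w → Adjacent u w
activeEdge-adjacent adjacent (xs , _ , refl , refl , activeMove {b} r) =
  trans (hamming-concat-[]≔ xs (activeBlock xs) b) (adjacent r)

module _ {n} {V : EdgeRel n} where

  private
    E : (x : Vertex n) → Even x → parity x ≡ false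
    E = even⇒parity≡false

    O : (x : Vertex n) → Odd x → parity x ≡ true
    O = odd⇒parity≡true

  Has-BinPS⇒activeEdge : ∀ {u w} → Has (BinPS V) u w → ActiveEdge (Has V) u w
  Has-BinPS⇒activeEdge (inj₁ (p1 {a} {b} {x₂} {x₃} {x₄} v e₂ e₃ e₄)) =
    activeEdge (a ∷ x₂ ∷ x₃ ∷ x₄ ∷ []) (patternBlock-VEEE (parity a) (E x₂ e₂) (E x₃ e₃) (E x₄ e₄)) (inj₁ v)
  Has-BinPS⇒activeEdge (inj₂ (p1 {a} {b} {x₂} {x₃} {x₄} v e₂ e₃ e₄)) =
    activeEdge (b ∷ x₂ ∷ x₃ ∷ x₄ ∷ []) (patternBlock-VEEE (parity b) (E x₂ e₂) (E x₃ e₃) (E x₄ e₄)) (inj₂ v)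
  Has-BinPS⇒activeEdge (inj₁ (p2 {x₁} {a} {b} {x₃} {x₄} e₁ v o₃ e₄)) =
    activeEdge (x₁ ∷ a ∷ x₃ ∷ x₄ ∷ []) (patternBlock-EVOE (parity a) (E x₁ e₁) (O x₃ o₃) (E x₄ e₄)) (inj₁ v)
  Has-BinPS⇒activeEdge (inj₂ (p2 {x₁} {a} {b} {x₃} {x₄} e₁ v o₃ e₄)) =
    activeEdge (x₁ ∷ b ∷ x₃ ∷ x₄ ∷ []) (patternBlock-EVOE (parity b) (E x₁ e₁) (O x₃ o₃) (E x₄ e₄)) (inj₂ v)
  Has-BinPS⇒activeEdge (inj₁ (p3 {x₁} {x₂} {a} {b} {x₄} e₁ e₂ v o₄)) =
    activeEdge (x₁ ∷ x₂ ∷ a ∷ x₄ ∷ []) (patternBlock-EEVO (parity a) (E x₁ e₁) (E x₂ e₂) (O x₄ o₄)) (inj₁ v)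
  Has-BinPS⇒activeEdge (inj₂ (p3 {x₁} {x₂} {a} {b} {x₄} e₁ e₂ v o₄)) =
    activeEdge (x₁ ∷ x₂ ∷ b ∷ x₄ ∷ []) (patternBlock-EEVO (parity b) (E x₁ e₁) (E x₂ e₂) (O x₄ o₄)) (inj₂ v)
  Has-BinPS⇒activeEdge (inj₁ (p4 {x₁} {x₂} {x₃} {a} {b} e₁ o₂ e₃ v)) =
    activeEdge (x₁ ∷ x₂ ∷ x₃ ∷ a ∷ []) (patternBlock-EOEV (parity a) (E x₁ e₁) (O x₂ o₂) (E x₃ e₃)) (inj₁ v)
  Has-BinPS⇒activeEdge (inj₂ (p4 {x₁} {x₂} {x₃} {a} {b} e₁ o₂ e₃ v)) =
    activeEdge (x₁ ∷ x₂ ∷ x₃ ∷ b ∷ []) (patternBlock-EOEV (parity b) (E x₁ e₁) (O x₂ o₂) (E x₃ e₃)) (inj₂ v)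
  Has-BinPS⇒activeEdge (inj₁ (p5 {a} {b} {x₂} {x₃} {x₄} v o₂ o₃ o₄)) =
    activeEdge (a ∷ x₂ ∷ x₃ ∷ x₄ ∷ []) (patternBlock-VOOO (parity a) (O x₂ o₂) (O x₃ o₃) (O x₄ o₄)) (inj₁ v)
  Has-BinPS⇒activeEdge (inj₂ (p5 {a} {b} {x₂} {x₃} {x₄} v o₂ o₃ o₄)) =
    activeEdge (b ∷ x₂ ∷ x₃ ∷ x₄ ∷ []) (patternBlock-VOOO (parity b) (O x₂ o₂) (O x₃ o₃) (O x₄ o₄)) (inj₂ v)
  Has-BinPS⇒activeEdge (inj₁ (p6 {x₁} {a} {b} {x₃} {x₄} o₁ v e₃ o₄)) =
    activeEdge (x₁ ∷ a ∷ x₃ ∷ x₄ ∷ []) (patternBlock-OVEO (parity a) (O x₁ o₁) (E x₃ e₃) (O x₄ o₄)) (inj₁ v)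
  Has-BinPS⇒activeEdge (inj₂ (p6 {x₁} {a} {b} {x₃} {x₄} o₁ v e₃ o₄)) =
    activeEdge (x₁ ∷ b ∷ x₃ ∷ x₄ ∷ []) (patternBlock-OVEO (parity b) (O x₁ o₁) (E x₃ e₃) (O x₄ o₄)) (inj₂ v)
  Has-BinPS⇒activeEdge (inj₁ (p7 {x₁} {x₂} {a} {b} {x₄} o₁ o₂ v e₄)) =
    activeEdge (x₁ ∷ x₂ ∷ a ∷ x₄ ∷ []) (patternBlock-OOVE (parity a) (O x₁ o₁) (O x₂ o₂) (E x₄ e₄)) (inj₁ v)
  Has-BinPS⇒activeEdge (inj₂ (p7 {x₁} {x₂} {a} {b} {x₄} o₁ o₂ v e₄)) =
    activeEdge (x₁ ∷ x₂ ∷ b ∷ x₄ ∷ []) (patternBlock-OOVE (parity b) (O x₁ o₁) (O x₂ o₂) (E x₄ e₄)) (inj₂ v)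
  Has-BinPS⇒activeEdge (inj₁ (p8 {x₁} {x₂} {x₃} {a} {b} o₁ e₂ o₃ v)) =
    activeEdge (x₁ ∷ x₂ ∷ x₃ ∷ a ∷ []) (patternBlock-OEOV (parity a) (O x₁ o₁) (E x₂ e₂) (O x₃ o₃)) (inj₁ v)
  Has-BinPS⇒activeEdge (inj₂ (p8 {x₁} {x₂} {x₃} {a} {b} o₁ e₂ o₃ v)) =
    activeEdge (x₁ ∷ x₂ ∷ x₃ ∷ b ∷ []) (patternBlock-OEOV (parity b) (O x₁ o₁) (E x₂ e₂) (O x₃ o₃)) (inj₂ v)

lemma1 : (n : ℕ) → 1 ≤ n → (V : EdgeRel n) → IsMatching V → IsMatching (BinPS V)
lemma1 _ _ V (adjacent , disjoint) =
  (λ _ _ e → activeEdge-adjacent (Has-adjacent adjacent) (Has-BinPS⇒activeEdge (inj₁ e))) ,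
  (λ _ _ _ e e′ → activeEdge-functional (disjoint _ _ _) (Has-BinPS⇒activeEdge e) (Has-BinPS⇒activeEdge e′))
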